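{- Let $t>1$ be odd, let $r\in\{1,2,3,4\}$ and let $S\subseteq\{i:1\le i\le 4t,\ i\equiv r\pmod 4\}$ with $|S|=k$. Then $$\sum_{\substack{5\le n\le 2t+2\\ n\equiv 1 \ (\mathrm{mod}\ 4)}} c_n(S)=\frac{k(t-k)}{2}.$$
   Context: $G=\mathbb{Z}_t\times\mathbb{Z}_2^2=\langle x,u,v\mid x^t=u^2=v^2=1,\ uv=vu\rangle$, with elements ordered $g_{4m+1}=x^m$, $g_{4m+2}=x^mu$, $g_{4m+3}=x^mv$, $g_{4m+4}=x^muv$ for $0\le m\le t-1$. For $1\le i\le 4t$ let $\delta_i:G\to\{\pm1\}$ with $\delta_i(g)=-1$ iff $g=g_i$. The generalized coboundary matrix $N_i$ is the $4t\times4t$ matrix with $(s,j)$ entry $\delta_i(g_j)\delta_i(g_sg_j)$. For a set $S$ of indices and a row $n$: form the graph on $\{N_i:i\in S\}$ in which two matrices are adjacent iff they have a $-1$ entry in a common position of row $n$; a connected component is called an $n$-path if some member of it has a $-1$ entry of row $n$ in a common position with some $N_j$, $1\le j\le4t$, $j\notin S$. $c_n(S)$ denotes the number of $n$-path components. -}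

module Defs where

open import Data.Nat using (ℕ; zero; suc; _+_; _*_; _∸_; _≤ᵇ_; _≡ᵇ_; NonZero)
open import Data.Nat.DivMod using (_/_; _%_)
open import Data.Bool using (Bool; true; false; _∧_; _∨_; not; _xor_)
open import Data.List using (List; []; _∷_; map; upTo; filterᵇ; length)
open import Data.Nat.ListAction using (sum)
open import Data.Bool.ListAction using (any; all)

-- Indices 1 ≤ j ≤ 4t encode g_j = x^m u^a v^b with
--   j = 4m + q + 1, q ∈ {0,1,2,3}, q = a + 2b
-- (q = 0 ↦ 1, q = 1 ↦ u, q = 2 ↦ v, q = 3 ↦ uv), exactly the paper's ordering.

expX : ℕ → ℕ
expX j = (j ∸ 1) / 4

expU : ℕ → ℕ
expU j = ((j ∸ 1) % 4) % 2

expV : ℕ → ℕ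
expV j = ((j ∸ 1) % 4) / 2

-- index of the product g_s g_j in G = Z_t × Z_2²
mul : (t : ℕ) ⦃ _ : NonZero t ⦄ → ℕ → ℕ → ℕ
mul t s j = 4 * ((expX s + expX j) % t) + (expU s + expU j) % 2
            + 2 * ((expV s + expV j) % 2) + 1

positions : ℕ → List ℕ
positions t = map suc (upTo (4 * t))

-- (N_i)_{s,j} = δ_i(g_j) δ_i(g_s g_j) is -1 iff exactly one of g_j, g_s g_j equals g_i
negEntry : (t : ℕ) ⦃ _ : NonZero t ⦄ → (i s j : ℕ) → Bool
negEntry t i s j = (j ≡ᵇ i) xor (mul t s j ≡ᵇ i)

shareRow : (t : ℕ) ⦃ _ : NonZero t ⦄ → (n i i' : ℕ) → Bool
shareRow t n i i' = any (λ j → negEntry t i n j ∧ negEntry t i' n j) (positions t)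

memb : ℕ → List ℕ → Bool
memb x S = any (λ y → y ≡ᵇ x) S

grow : (t : ℕ) ⦃ _ : NonZero t ⦄ → (n : ℕ) → List ℕ → (ℕ → Bool) → ℕ → Bool
grow t n S R v = R v ∨ (memb v S ∧ any (λ w → R w ∧ shareRow t n w v) S)

iter : ℕ → ((ℕ → Bool) → ℕ → Bool) → (ℕ → Bool) → ℕ → Bool
iter zero    f R = R
iter (suc m) f R = iter m f (f R)

-- conn t n S i v: N_v lies in the connected component of N_i in the graph on
-- {N_i : i ∈ S} (a walk in a graph with |S| vertices has at most |S| edges
-- without repetition, so |S| growth steps reach the whole component)
conn : (t : ℕ) ⦃ _ : NonZero t ⦄ → (n : ℕ) → List ℕ → ℕ → ℕ → Bool
conn t n S i = iter (length S) (grow t n S) (λ v → v ≡ᵇ i)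

-- the component of N_i is an n-path: some member shares a -1 entry of row n
-- with some N_j, 1 ≤ j ≤ 4t, j ∉ S
isPathComp : (t : ℕ) ⦃ _ : NonZero t ⦄ → (n : ℕ) → List ℕ → ℕ → Bool
isPathComp t n S i =
  any (λ w → conn t n S i w ∧
             any (λ j → not (memb j S) ∧ shareRow t n w j) (positions t)) S

isRep : (t : ℕ) ⦃ _ : NonZero t ⦄ → (n : ℕ) → List ℕ → ℕ → Bool
isRep t n S i = all (λ w → not (conn t n S i w) ∨ (i ≤ᵇ w)) S

-- c_n(S): number of n-path components (counted via their least-index members)
c : (t : ℕ) ⦃ _ : NonZero t ⦄ → (n : ℕ) → List ℕ → ℕ
c t n S = length (filterᵇ (λ i → isRep t n S i ∧ isPathComp t n S i) S)

rows : ℕ → List ℕ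
rows t = filterᵇ (λ n → n % 4 ≡ᵇ 1) (map (5 +_) (upTo (2 * t ∸ 2)))

sumC : (t : ℕ) ⦃ _ : NonZero t ⦄ → List ℕ → ℕ
sumC t S = sum (map (λ n → c t n S) (rows t))

-- Row n = 4m+1 of N_i has its −1 entries exactly in the columns of g_i and of x^(−m) g_i.
-- Hence N_v and N_w share such a position iff g_w ∈ {g_v, x^m g_v, x^(−m) g_v}: on S the
-- graph is a union of arcs of x^m-orbits, and an n-path component is an arc that is not a
-- whole orbit, with exactly one last element a (x^m a ∉ S). So c_n(S) counts the a ∈ S with
-- x^m a ∉ S, and equally those with x^(−m) a ∉ S. For t = 2h+1 the exponents ±m, 1 ≤ m ≤ h,
-- run once through 1, …, t−1, hence 2 Σ c_n(S) = Σ_{a ∈ S} #{1 ≤ d < t : x^d a ∉ S}; as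
-- d ↦ x^d a maps 0, …, t−1 bijectively onto the coset of a, which contains S, each a
-- contributes (t − 1) − (k − 1).

module Submission where

open import Algebra.Properties.CommutativeSemigroup using (interchange)
open import Data.Bool using (Bool; true; false; T; T?; not; _∧_; _∨_; _xor_; if_then_else_)
import Data.Bool as Bool
open import Data.Bool.ListAction using (any; or)
open import Data.Bool.Properties using (T-≡; T-∧; T-∨; ∨-identityʳ)
open import Data.Empty using (⊥-elim)
open import Data.List
  using (List; []; _∷_; _++_; length; map; reverse; filterᵇ; applyUpTo; applyDownFrom; upTo)
open import Data.List.Extrema.Nat using (min; argmin-all; min≤xs)
open import Data.List.Membership.Propositional using (_∈_; _∉_; find; lose)
open import Data.List.Membership.Propositional.Properties
  using (∈-∃++; ∈-++⁺ˡ; ∈-++⁺ʳ; ∈-++⁻; ∈-filter⁺; ∈-filter⁻; ∈-map⁺; ∈-map⁻; ∈-upTo⁺; ∈-upTo⁻)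
open import Data.List.Properties
  using ( length-++-sucʳ; length-upTo; length-filter; map-cong; map-cong-local; map-upTo
        ; map-applyUpTo; filter-some; filter-accept; filter-reject; reverse-applyUpTo)
open import Data.List.Relation.Binary.Permutation.Propositional.Properties using (↭-reverse)
open import Data.List.Relation.Unary.All as All using (All; all?)
open import Data.List.Relation.Unary.All.Properties using (¬All⇒Any¬; all⁺; all⁻)
open import Data.List.Relation.Unary.Any using (here; there)
open import Data.List.Relation.Unary.Any.Properties using (any⁺; any⁻)
open import Data.List.Relation.Unary.Unique.Propositional using (Unique; _∷_)
open import Data.List.Relation.Unary.Unique.Propositional.Properties using (filter⁺; upTo⁺)
open import Data.Nat
  using (ℕ; zero; suc; pred; _+_; _*_; _∸_; _≤_; _<_; z≤n; s≤s; z<s; _≡ᵇ_; NonZero; >-nonZero⁻¹)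
open import Data.Nat.DivMod
open import Data.Nat.Divisibility using (divides-refl)
open import Data.Nat.ListAction using (sum)
open import Data.Nat.ListAction.Properties using (sum-↭; sum-++)
open import Data.Nat.Properties
open import Data.Nat.Tactic.RingSolver using (solve-∀)
open import Data.List.Membership.DecPropositional _≟_ using (_∈?_)
open import Data.Product using (∃-syntax; _×_; _,_; proj₁; proj₂)
open import Data.Sum using (_⊎_; inj₁; inj₂; swap; map₂)
open import Function using (Equivalence; _⇔_; mk⇔; flip; _∘_; id)
open import Function.Endo.Propositional ℕ using (_^_)
open import Relation.Binary.PropositionalEquality
open import Relation.Nullary using (¬_; yes; no)

open import Defs

private
  variable
    A B : Set

¬T⇒≡false : ∀ {b} → ¬ T b → b ≡ false
¬T⇒≡false {false} _  = refl
¬T⇒≡false {true}  ¬b = ⊥-elim (¬b _)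

T-not⁺ : ∀ {b} → ¬ T b → T (not b)
T-not⁺ {false} _  = _
T-not⁺ {true}  ¬b = ¬b _

T-not⁻ : ∀ {b} → T (not b) → ¬ T b
T-not⁻ {false} _ ()

T-implication⁺ : ∀ {a b} → (T a → T b) → T (not a ∨ b)
T-implication⁺ {false} _   = _
T-implication⁺ {true}  a⇒b = a⇒b _

T-implication⁻ : ∀ {a b} → T (not a ∨ b) → T a → T b
T-implication⁻ {true} b _ = b

T-xor⁺ˡ : ∀ {a b} → T a → ¬ T b → T (a xor b)
T-xor⁺ˡ {true} _ ¬b = T-not⁺ ¬b

T-xor⁺ʳ : ∀ {a b} → ¬ T a → T b → T (a xor b)
T-xor⁺ʳ {false} _ b  = b
T-xor⁺ʳ {true}  ¬a _ = ⊥-elim (¬a _)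

T-xor⁻ : ∀ {a b} → T (a xor b) → T a ⊎ T b
T-xor⁻ {true}  _ = inj₁ _
T-xor⁻ {false} b = inj₂ b

newly-true : ∀ {b c} → (T b → T c) → c ≢ b → ¬ T b × T c
newly-true {true}  {true}  _   c≢b = ⊥-elim (c≢b refl)
newly-true {true}  {false} b⇒c _   = ⊥-elim (b⇒c _)
newly-true {false} {true}  _   _   = (λ ()) , _
newly-true {false} {false} _   c≢b = ⊥-elim (c≢b refl)

any-witness : (p : A → Bool) (xs : List A) → T (any p xs) → ∃[ x ] x ∈ xs × T (p x)
any-witness p xs h = find (any⁻ p xs h)

any-intro : (p : A → Bool) {x : A} {xs : List A} → x ∈ xs → T (p x) → T (any p xs)
any-intro p x∈xs px = any⁺ p (lose x∈xs px)

memb⇒∈ : ∀ {x} xs → T (memb x xs) → x ∈ xs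
memb⇒∈ {x} xs h with y , y∈xs , y≡x ← any-witness (_≡ᵇ x) xs h = subst (_∈ xs) (≡ᵇ⇒≡ y x y≡x) y∈xs

∈⇒memb : ∀ {x xs} → x ∈ xs → T (memb x xs)
∈⇒memb {x} x∈xs = any-intro (_≡ᵇ x) x∈xs (≡⇒≡ᵇ x x refl)

count : (A → Bool) → List A → ℕ
count p xs = length (filterᵇ p xs)

count-mono : {p q : A → Bool} → (∀ {x} → T (p x) → T (q x)) → ∀ xs → count p xs ≤ count q xs
count-mono {p = p} {q} p⊆q []       = z≤n
count-mono {p = p} {q} p⊆q (x ∷ xs) with p x in px | q x in qx
... | true  | true  = s≤s (count-mono p⊆q xs)
... | true  | false = ⊥-elim (subst T qx (p⊆q (subst T (sym px) _)))
... | false | true  = m≤n⇒m≤1+n (count-mono p⊆q xs)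
... | false | false = count-mono p⊆q xs

count-mono-< : {p q : A → Bool} → (∀ {x} → T (p x) → T (q x)) →
  ∀ {v xs} → v ∈ xs → ¬ T (p v) → T (q v) → count p xs < count q xs
count-mono-< {p = p} {q} p⊆q {xs = x ∷ xs} v∈ ¬pv qv with p x in px | q x in qx | v∈
... | true  | false | _          = ⊥-elim (subst T qx (p⊆q (subst T (sym px) _)))
... | true  | true  | here refl  = ⊥-elim (¬pv (subst T (sym px) _))
... | true  | true  | there v∈xs = s≤s (count-mono-< p⊆q v∈xs ¬pv qv)
... | false | true  | here refl  = s≤s (count-mono p⊆q xs)
... | false | true  | there v∈xs = m≤n⇒m≤1+n (count-mono-< p⊆q v∈xs ¬pv qv)
... | false | false | here refl  = ⊥-elim (subst T qx qv)
... | false | false | there v∈xs = count-mono-< p⊆q v∈xs ¬pv qv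

count-complement : (p : A → Bool) (xs : List A) → count (λ x → not (p x)) xs + count p xs ≡ length xs
count-complement p [] = refl
count-complement p (x ∷ xs) with p x
... | true  = trans (+-suc _ _) (cong suc (count-complement p xs))
... | false = cong suc (count-complement p xs)

indicator : Bool → ℕ
indicator b = if b then 1 else 0

count-∷ : (p : A → Bool) (x : A) (xs : List A) → count p (x ∷ xs) ≡ indicator (p x) + count p xs
count-∷ p x xs with p x
... | true  = refl
... | false = refl

count-as-sum : (p : A → Bool) (xs : List A) → count p xs ≡ sum (map (λ x → indicator (p x)) xs)
count-as-sum p []       = refl
count-as-sum p (x ∷ xs) = trans (count-∷ p x xs) (cong (indicator (p x) +_) (count-as-sum p xs))

private
  delete : {y : A} {ys : List A} → y ∈ ys →
    ∃[ zs ] length ys ≡ suc (length zs) × (∀ {z} → z ∈ ys → z ≢ y → z ∈ zs)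
  delete y∈ys with us , vs , refl ← ∈-∃++ y∈ys =
    us ++ vs , length-++-sucʳ us _ vs , keep
    where
    keep : ∀ {z} → z ∈ us ++ _ ∷ vs → z ≢ _ → z ∈ us ++ vs
    keep z∈ z≢y with ∈-++⁻ us z∈
    ... | inj₁ z∈us = ∈-++⁺ˡ z∈us
    ... | inj₂ (here refl) = ⊥-elim (z≢y refl)
    ... | inj₂ (there z∈vs) = ∈-++⁺ʳ us z∈vs

unique-length-≤ : (R : A → B → Set) {xs : List A} {ys : List B} → Unique xs →
  (∀ {x} → x ∈ xs → ∃[ y ] y ∈ ys × R x y) →
  (∀ {x x′ y} → x ∈ xs → x′ ∈ xs → R x y → R x′ y → x ≡ x′) →
  length xs ≤ length ys
unique-length-≤ R {[]} _ _ _ = z≤n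
unique-length-≤ R {x ∷ xs} {ys} (x∉xs ∷ u) total inj
  with y , y∈ys , Rxy ← total (here refl)
  with zs , len , kept ← delete y∈ys
  rewrite len = s≤s (unique-length-≤ R u total′ (λ p q → inj (there p) (there q)))
  where
  total′ : ∀ {x′} → x′ ∈ xs → ∃[ z ] z ∈ zs × R x′ z
  total′ x′∈xs with z , z∈ys , Rx′z ← total (there x′∈xs) =
    z , kept z∈ys (λ { refl → All.lookup x∉xs x′∈xs (inj (here refl) (there x′∈xs) Rxy Rx′z) }) , Rx′z

unique-length-≡ : (R : A → B → Set) {xs : List A} {ys : List B} → Unique xs → Unique ys →
  (∀ {x} → x ∈ xs → ∃[ y ] y ∈ ys × R x y) →
  (∀ {y} → y ∈ ys → ∃[ x ] x ∈ xs × R x y) →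
  (∀ {x x′ y} → x ∈ xs → x′ ∈ xs → R x y → R x′ y → x ≡ x′) →
  (∀ {x y y′} → y ∈ ys → y′ ∈ ys → R x y → R x y′ → y ≡ y′) →
  length xs ≡ length ys
unique-length-≡ R uxs uys total⃗ total⃖ inj⃗ inj⃖ =
  ≤-antisym (unique-length-≤ R uxs total⃗ inj⃗) (unique-length-≤ (flip R) uys total⃖ inj⃖)

sum-map-+ : (f g : A → ℕ) (xs : List A) →
  sum (map (λ x → f x + g x) xs) ≡ sum (map f xs) + sum (map g xs)
sum-map-+ f g []       = refl
sum-map-+ f g (x ∷ xs) =
  trans (cong (f x + g x +_) (sum-map-+ f g xs)) (interchange +-commutativeSemigroup (f x) (g x) _ _)

sum-map-const : (n : ℕ) (xs : List A) → sum (map (λ _ → n) xs) ≡ length xs * n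
sum-map-const n []       = refl
sum-map-const n (x ∷ xs) = cong (n +_) (sum-map-const n xs)

sum-count-swap : (P : A → B → Bool) (xs : List A) (ys : List B) →
  sum (map (λ x → count (P x) ys) xs) ≡ sum (map (λ y → count (λ x → P x y) xs) ys)
sum-count-swap P []       ys = sym (trans (sum-map-const 0 ys) (*-zeroʳ (length ys)))
sum-count-swap P (x ∷ xs) ys = begin
  count (P x) ys + sum (map (λ x → count (P x) ys) xs)
    ≡⟨ cong₂ _+_ (count-as-sum (P x) ys) (sum-count-swap P xs ys) ⟩
  sum (map (λ y → indicator (P x y)) ys) + sum (map (λ y → count (λ x → P x y) xs) ys)
    ≡⟨ sum-map-+ _ _ ys ⟨
  sum (map (λ y → indicator (P x y) + count (λ x → P x y) xs) ys)
    ≡⟨ cong sum (map-cong (λ y → count-∷ (λ x → P x y) x xs) ys) ⟨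
  sum (map (λ y → count (λ x → P x y) (x ∷ xs)) ys) ∎
  where open ≡-Reasoning

applyUpTo-cong : ∀ {f g : ℕ → A} n → (∀ {x} → x < n → f x ≡ g x) → applyUpTo f n ≡ applyUpTo g n
applyUpTo-cong zero    f≡g = refl
applyUpTo-cong (suc n) f≡g = cong₂ _∷_ (f≡g z<s) (applyUpTo-cong n (f≡g ∘ s≤s))

applyUpTo-+ : ∀ (f : ℕ → A) m n → applyUpTo f (m + n) ≡ applyUpTo f m ++ applyUpTo (λ x → f (m + x)) n
applyUpTo-+ f zero    n = refl
applyUpTo-+ f (suc m) n = cong (f 0 ∷_) (applyUpTo-+ (f ∘ suc) m n)

applyDownFrom≡applyUpTo : ∀ (f : ℕ → A) n → applyDownFrom f n ≡ applyUpTo (λ x → f (n ∸ suc x)) n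
applyDownFrom≡applyUpTo f zero    = refl
applyDownFrom≡applyUpTo f (suc n) = cong (f n ∷_) (applyDownFrom≡applyUpTo f n)

sum-applyUpTo-reverse : ∀ (f : ℕ → ℕ) n → sum (applyUpTo (λ x → f (n ∸ suc x)) n) ≡ sum (applyUpTo f n)
sum-applyUpTo-reverse f n = begin
  sum (applyUpTo (λ x → f (n ∸ suc x)) n) ≡⟨ cong sum (applyDownFrom≡applyUpTo f n) ⟨
  sum (applyDownFrom f n)                 ≡⟨ cong sum (reverse-applyUpTo f n) ⟨
  sum (reverse (applyUpTo f n))           ≡⟨ sum-↭ (↭-reverse (applyUpTo f n)) ⟩
  sum (applyUpTo f n)                     ∎
  where open ≡-Reasoning

-- Indices of G = ℤ_t × ℤ₂² and the action of x

-- klein i = expU i + 2 · expV i, and translate t d i is the index of x^d g_i.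
klein : ℕ → ℕ
klein i = (i ∸ 1) % 4

IsIndex : ℕ → ℕ → Set
IsIndex t i = 1 ≤ i × i ≤ 4 * t

translate : (t : ℕ) ⦃ _ : NonZero t ⦄ → ℕ → ℕ → ℕ
translate t d i = suc (klein i + (d + expX i) % t * 4)

klein<4 : ∀ i → klein i < 4
klein<4 i = m%n<n (i ∸ 1) 4

index-decomposition : ∀ {i} → 1 ≤ i → i ≡ suc (klein i + expX i * 4)
index-decomposition {suc i} _ = cong suc (m≡m%n+[m/n]*n i 4)

expX-decomposition : ∀ {q} x → q < 4 → expX (suc (q + x * 4)) ≡ x
expX-decomposition {q} x q<4 = begin
  (q + x * 4) / 4     ≡⟨ +-distrib-/-∣ʳ q (divides-refl x) ⟩
  q / 4 + x * 4 / 4   ≡⟨ cong₂ _+_ (m<n⇒m/n≡0 q<4) (m*n/n≡m x 4) ⟩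
  x                   ∎
  where open ≡-Reasoning

klein-decomposition : ∀ {q} x → q < 4 → klein (suc (q + x * 4)) ≡ q
klein-decomposition {q} x q<4 = trans ([m+kn]%n≡m%n q x 4) (m<n⇒m%n≡m q<4)

module _ (t : ℕ) ⦃ _ : NonZero t ⦄ where

  %-absorbˡ : ∀ x y → (x % t + y) % t ≡ (x + y) % t
  %-absorbˡ x y = begin
    (x % t + y) % t           ≡⟨ %-distribˡ-+ (x % t) y t ⟩
    (x % t % t + y % t) % t   ≡⟨ cong (λ z → (z + y % t) % t) (m%n%n≡m%n x t) ⟩
    (x % t + y % t) % t       ≡⟨ %-distribˡ-+ x y t ⟨
    (x + y) % t               ∎
    where open ≡-Reasoning

  %-+∸-cancel : ∀ x {a} → a ≤ t → (x + a + (t ∸ a)) % t ≡ x % t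
  %-+∸-cancel x {a} a≤t = begin
    (x + a + (t ∸ a)) % t   ≡⟨ cong (_% t) (+-assoc x a (t ∸ a)) ⟩
    (x + (a + (t ∸ a))) % t ≡⟨ cong (λ z → (x + z) % t) (m+[n∸m]≡n a≤t) ⟩
    (x + t) % t             ≡⟨ [m+n]%n≡m%n x t ⟩
    x % t                   ∎
    where open ≡-Reasoning

  expX<t : ∀ {i} → IsIndex t i → expX i < t
  expX<t {suc i} (_ , i<4t) = m<n*o⇒m/o<n (subst (i <_) (*-comm 4 t) i<4t)

  expX-translate : ∀ d i → expX (translate t d i) ≡ (d + expX i) % t
  expX-translate d i = expX-decomposition ((d + expX i) % t) (klein<4 i)

  klein-translate : ∀ d i → klein (translate t d i) ≡ klein i
  klein-translate d i = klein-decomposition ((d + expX i) % t) (klein<4 i)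

  translate-isIndex : ∀ d i → IsIndex t (translate t d i)
  translate-isIndex d i = s≤s z≤n , subst (translate t d i ≤_) (*-comm t 4) bound
    where
    X : ℕ
    X = (d + expX i) % t
    bound : suc (klein i + X * 4) ≤ t * 4
    bound = ≤-trans (+-monoˡ-< (X * 4) (klein<4 i)) (*-monoˡ-≤ 4 (m%n<n (d + expX i) t))

  translate-∘ : ∀ d e i → translate t d (translate t e i) ≡ translate t (d + e) i
  translate-∘ d e i = cong₂ (λ q z → suc (q + z * 4)) (klein-translate e i) (begin
    (d + expX (translate t e i)) % t ≡⟨ cong (λ z → (d + z) % t) (expX-translate e i) ⟩
    (d + (e + expX i) % t) % t       ≡⟨ cong (_% t) (+-comm d _) ⟩
    ((e + expX i) % t + d) % t       ≡⟨ %-absorbˡ (e + expX i) d ⟩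
    (e + expX i + d) % t             ≡⟨ cong (_% t) (+-comm (e + expX i) d) ⟩
    (d + (e + expX i)) % t           ≡⟨ cong (_% t) (+-assoc d e (expX i)) ⟨
    (d + e + expX i) % t             ∎)
    where open ≡-Reasoning

  translate-multiple : ∀ d {i} → d % t ≡ 0 → IsIndex t i → translate t d i ≡ i
  translate-multiple d {i} d%t≡0 i-idx = sym (trans (index-decomposition (proj₁ i-idx))
      (cong (λ z → suc (klein i + z * 4)) (sym X≡expX)))
    where
    X≡expX : (d + expX i) % t ≡ expX i
    X≡expX = begin
      (d + expX i) % t       ≡⟨ %-absorbˡ d (expX i) ⟨
      (d % t + expX i) % t   ≡⟨ cong (λ z → (z + expX i) % t) d%t≡0 ⟩
      expX i % t             ≡⟨ m<n⇒m%n≡m (expX<t i-idx) ⟩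
      expX i                 ∎
      where open ≡-Reasoning

  translate-injective : ∀ {d d′ i} → d < t → d′ < t → IsIndex t i →
    translate t d i ≡ translate t d′ i → d ≡ d′
  translate-injective {d} {d′} {i} d<t d′<t i-idx eq = begin
    d                                      ≡⟨ m<n⇒m%n≡m d<t ⟨
    d % t                                  ≡⟨ %-+∸-cancel d a≤t ⟨
    (d + expX i + (t ∸ expX i)) % t        ≡⟨ %-absorbˡ (d + expX i) _ ⟨
    ((d + expX i) % t + (t ∸ expX i)) % t  ≡⟨ cong (λ z → (z + (t ∸ expX i)) % t) same ⟩
    ((d′ + expX i) % t + (t ∸ expX i)) % t ≡⟨ %-absorbˡ (d′ + expX i) _ ⟩
    (d′ + expX i + (t ∸ expX i)) % t       ≡⟨ %-+∸-cancel d′ a≤t ⟩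
    d′ % t                                 ≡⟨ m<n⇒m%n≡m d′<t ⟩
    d′                                     ∎
    where
    open ≡-Reasoning
    a≤t : expX i ≤ t
    a≤t = <⇒≤ (expX<t i-idx)
    same : (d + expX i) % t ≡ (d′ + expX i) % t
    same = trans (sym (expX-translate d i)) (trans (cong expX eq) (expX-translate d′ i))

  translate-onto : ∀ {a b} → IsIndex t a → IsIndex t b → klein a ≡ klein b →
    ∃[ d ] d < t × translate t d a ≡ b
  translate-onto {a} {b} a-idx b-idx same-klein = d , m%n<n _ t , (begin
    suc (klein a + (d + expX a) % t * 4)  ≡⟨ cong₂ (λ q z → suc (q + z * 4)) same-klein lands ⟩
    suc (klein b + expX b * 4)            ≡⟨ index-decomposition (proj₁ b-idx) ⟨
    b                                     ∎)
    where
    open ≡-Reasoning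
    d : ℕ
    d = (expX b + (t ∸ expX a)) % t
    lands : (d + expX a) % t ≡ expX b
    lands = begin
      (d + expX a) % t                        ≡⟨ %-absorbˡ _ (expX a) ⟩
      (expX b + (t ∸ expX a) + expX a) % t    ≡⟨ cong (_% t) (+-assoc (expX b) _ _) ⟩
      (expX b + ((t ∸ expX a) + expX a)) % t
        ≡⟨ cong (λ z → (expX b + z) % t) (m∸n+n≡m (<⇒≤ (expX<t a-idx))) ⟩
      (expX b + t) % t                        ≡⟨ [m+n]%n≡m%n (expX b) t ⟩
      expX b % t                              ≡⟨ m<n⇒m%n≡m (expX<t b-idx) ⟩
      expX b                                  ∎

  translate-zero : ∀ {i} → IsIndex t i → translate t 0 i ≡ i
  translate-zero = translate-multiple 0 (m*n%n≡0 0 t)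

  translate-cancel : ∀ {d e i} → (d + e) % t ≡ 0 → IsIndex t i → translate t e (translate t d i) ≡ i
  translate-cancel {d} {e} {i} d+e≡0 i-idx =
    trans (translate-∘ e d i) (translate-multiple (e + d) (trans (cong (_% t) (+-comm e d)) d+e≡0) i-idx)

  translate-moves : ∀ {d i} → 0 < d → d < t → IsIndex t i → translate t d i ≢ i
  translate-moves 0<d d<t i-idx moved = <⇒≢ 0<d (sym
    (translate-injective d<t (>-nonZero⁻¹ t) i-idx (trans moved (sym (translate-zero i-idx)))))

  translate-^ : ∀ d {i} → IsIndex t i → ∀ k → (translate t d ^ k) i ≡ translate t (k * d) i
  translate-^ d i-idx zero    = sym (translate-zero i-idx)
  translate-^ d {i} i-idx (suc k) =
    trans (cong (translate t d) (translate-^ d i-idx k)) (translate-∘ d (k * d) i)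

  translate-inverse-reachable : ∀ {d e i} → (d + e) % t ≡ 0 → IsIndex t i →
    (translate t d ^ pred t) i ≡ translate t e i
  translate-inverse-reachable {d} {e} {i} d+e≡0 i-idx = begin
    x                          ≡⟨ translate-cancel d+e≡0 x-idx ⟨
    translate t e (translate t d x)  ≡⟨ cong (translate t e) full-turn ⟩
    translate t e i            ∎
    where
    open ≡-Reasoning
    x : ℕ
    x = (translate t d ^ pred t) i
    x-idx : IsIndex t x
    x-idx = subst (IsIndex t) (sym (translate-^ d i-idx (pred t))) (translate-isIndex _ i)
    t*d≡0 : t * d % t ≡ 0
    t*d≡0 = trans (cong (_% t) (*-comm t d)) (m*n%n≡0 d t)
    full-turn : translate t d x ≡ i
    full-turn = begin
      (translate t d ^ suc (pred t)) i   ≡⟨ translate-^ d i-idx (suc (pred t)) ⟩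
      translate t (suc (pred t) * d) i   ≡⟨ cong (λ z → translate t (z * d) i) (suc-pred t) ⟩
      translate t (t * d) i              ≡⟨ translate-multiple (t * d) t*d≡0 i-idx ⟩
      i                                  ∎

klein-from-mod-4 : ∀ {i} → 1 ≤ i → klein i ≡ (i % 4 + 3) % 4
klein-from-mod-4 {suc i} _ = begin
  i % 4              ≡⟨ [m+n]%n≡m%n i 4 ⟨
  (i + 4) % 4        ≡⟨ cong (_% 4) (+-suc i 3) ⟩
  (suc i + 3) % 4    ≡⟨ %-absorbˡ 4 (suc i) 3 ⟨
  (suc i % 4 + 3) % 4 ∎
  where open ≡-Reasoning

∈-positions⁻ : ∀ {t j} → j ∈ positions t → IsIndex t j
∈-positions⁻ j∈ with k , k∈ , refl ← ∈-map⁻ suc j∈ = s≤s z≤n , ∈-upTo⁻ k∈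

∈-positions⁺ : ∀ {t j} → IsIndex t j → j ∈ positions t
∈-positions⁺ {j = suc k} (_ , k<4t) = ∈-map⁺ suc (∈-upTo⁺ k<4t)

module _ (t : ℕ) ⦃ _ : NonZero t ⦄ {a : ℕ} {S : List ℕ} (a-idx : IsIndex t a) (S-unique : Unique S)
  (S-coset : ∀ {b} → b ∈ S → IsIndex t b × klein b ≡ klein a) where

  private
    hit : ℕ → Bool
    hit d = memb (translate t d a) S

  count-translates-∈ : count hit (upTo t) ≡ length S
  count-translates-∈ =
    unique-length-≡ (λ d b → translate t d a ≡ b) (filter⁺ (T? ∘ hit) (upTo⁺ t)) S-unique
      (λ d∈ → _ , memb⇒∈ S (proj₂ (∈-filter⁻ (T? ∘ hit) {xs = upTo t} d∈)) , refl)
      onto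
      (λ d∈ d′∈ e e′ → translate-injective t (shift<t d∈) (shift<t d′∈) a-idx (trans e (sym e′)))
      (λ _ _ e e′ → trans (sym e) e′)
    where
    shift<t : ∀ {d} → d ∈ filterᵇ hit (upTo t) → d < t
    shift<t d∈ = ∈-upTo⁻ (proj₁ (∈-filter⁻ (T? ∘ hit) {xs = upTo t} d∈))
    onto : ∀ {b} → b ∈ S → ∃[ d ] d ∈ filterᵇ hit (upTo t) × translate t d a ≡ b
    onto b∈S with b-idx , same ← S-coset b∈S
      with d , d<t , eq ← translate-onto t a-idx b-idx (sym same)
      = d , ∈-filter⁺ (T? ∘ hit) (∈-upTo⁺ d<t) (∈⇒memb (subst (_∈ S) (sym eq) b∈S)) , eq

  count-translates-∉ : count (λ d → not (hit d)) (upTo t) ≡ t ∸ length S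
  count-translates-∉ = begin
    count (λ d → not (hit d)) (upTo t)
      ≡⟨ m+n∸n≡m _ (count hit (upTo t)) ⟨
    count (λ d → not (hit d)) (upTo t) + count hit (upTo t) ∸ count hit (upTo t)
      ≡⟨ cong₂ _∸_ (trans (count-complement hit (upTo t)) (length-upTo t)) count-translates-∈ ⟩
    t ∸ length S ∎
    where open ≡-Reasoning

-- Components of the graph on {N_i : i ∈ S}

iter-suc : ∀ j (f : (ℕ → Bool) → ℕ → Bool) R → iter (suc j) f R ≡ f (iter j f R)
iter-suc zero    f R = refl
iter-suc (suc j) f R = iter-suc j f (f R)

module Connectivity (t : ℕ) ⦃ _ : NonZero t ⦄ (n : ℕ) (S : List ℕ) where

  data Walk (i : ℕ) : ℕ → Set where
    start : Walk i i
    step  : ∀ {u v} → Walk i u → u ∈ S → v ∈ S → T (shareRow t n u v) → Walk i v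

  walk-++ : ∀ {i u v} → Walk i u → Walk u v → Walk i v
  walk-++ p start            = p
  walk-++ p (step q u∈ v∈ e) = step (walk-++ p q) u∈ v∈ e

  private
    grow′ : (ℕ → Bool) → ℕ → Bool
    grow′ = grow t n S

    marked : ℕ → ℕ → ℕ → Bool
    marked i j = iter j grow′ (_≡ᵇ i)

  grow-⊇ : ∀ R {v} → T (R v) → T (grow′ R v)
  grow-⊇ R Rv = Equivalence.from T-∨ (inj₁ Rv)

  iter-⊇ : ∀ j R {v} → T (R v) → T (iter j grow′ R v)
  iter-⊇ zero    R Rv = Rv
  iter-⊇ (suc j) R Rv = iter-⊇ j (grow′ R) (grow-⊇ R Rv)

  grow-along-edge : ∀ R {u v} → u ∈ S → v ∈ S → T (R u) → T (shareRow t n u v) → T (grow′ R v)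
  grow-along-edge R u∈S v∈S Ru e = Equivalence.from T-∨ (inj₂ (Equivalence.from T-∧
    (∈⇒memb v∈S , any-intro _ u∈S (Equivalence.from T-∧ (Ru , e)))))

  grow-sound : ∀ {i} R → (∀ {v} → T (R v) → Walk i v) → ∀ {v} → T (grow′ R v) → Walk i v
  grow-sound R sound {v} h with Equivalence.to T-∨ h
  ... | inj₁ Rv  = sound Rv
  ... | inj₂ new with v-memb , joined ← Equivalence.to T-∧ new
    with u , u∈S , Ru∧e ← any-witness _ S joined
    with Ru , e ← Equivalence.to T-∧ Ru∧e
    = step (sound Ru) u∈S (memb⇒∈ S v-memb) e

  iter-sound : ∀ {i} j R → (∀ {v} → T (R v) → Walk i v) → ∀ {v} → T (iter j grow′ R v) → Walk i v
  iter-sound zero    R sound = sound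
  iter-sound (suc j) R sound = iter-sound j (grow′ R) (grow-sound R sound)

  conn⇒walk : ∀ {i v} → T (conn t n S i v) → Walk i v
  conn⇒walk {i} =
    iter-sound (length S) (_≡ᵇ i) λ {v} v≡i → subst (Walk i) (sym (≡ᵇ⇒≡ v i v≡i)) start

  Closed : (ℕ → Bool) → Set
  Closed R = ∀ v → grow′ R v ≡ R v

  grow-cong : ∀ {R R′} → (∀ v → R v ≡ R′ v) → ∀ v → grow′ R v ≡ grow′ R′ v
  grow-cong R≗R′ v = cong₂ _∨_ (R≗R′ v)
    (cong (λ b → memb v S ∧ or b) (map-cong (λ w → cong (_∧ shareRow t n w v) (R≗R′ w)) S))

  closed-on-S : ∀ R → (∀ {v} → v ∈ S → grow′ R v ≡ R v) → Closed R
  closed-on-S R closed v with T? (memb v S)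
  ... | yes v∈S = closed (memb⇒∈ S v∈S)
  ... | no  v∉S = trans (cong (λ b → R v ∨ (b ∧ any (λ w → R w ∧ shareRow t n w v) S)) (¬T⇒≡false v∉S))
                        (∨-identityʳ (R v))

  closed-or-growing-step : ∀ {j} R → Closed R ⊎ j < count R S →
    Closed (grow′ R) ⊎ suc j < count (grow′ R) S
  closed-or-growing-step R (inj₁ closed) = inj₁ (grow-cong closed)
  closed-or-growing-step R (inj₂ j<#R) with all? (λ v → grow′ R v Bool.≟ R v) S
  ... | yes stable   = inj₁ (grow-cong (closed-on-S R (All.lookup stable)))
  ... | no  unstable
    with v , v∈S , changed ← find (¬All⇒Any¬ (λ v → grow′ R v Bool.≟ R v) S unstable)
    with ¬Rv , grownv ← newly-true (grow-⊇ R) changed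
    = inj₂ (≤-trans (s≤s j<#R) (count-mono-< (grow-⊇ R) v∈S ¬Rv grownv))

  -- A growth step that is not closed marks a new element of S, so after |S| steps the set is closed.
  closed-or-growing : ∀ {i} → i ∈ S → ∀ j → Closed (marked i j) ⊎ j < count (marked i j) S
  closed-or-growing {i} i∈S zero    = inj₂ (filter-some (T? ∘ (_≡ᵇ i)) (lose i∈S (≡⇒≡ᵇ i i refl)))
  closed-or-growing {i} i∈S (suc j) =
    subst (λ R → Closed R ⊎ suc j < count R S) (sym (iter-suc j grow′ (_≡ᵇ i)))
      (closed-or-growing-step (marked i j) (closed-or-growing i∈S j))

  conn-closed : ∀ {i} → i ∈ S → Closed (conn t n S i)
  conn-closed {i} i∈S with closed-or-growing i∈S (length S)
  ... | inj₁ closed = closed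
  ... | inj₂ |S|<#R = ⊥-elim (<⇒≱ |S|<#R (length-filter (T? ∘ conn t n S i) S))

  walk⇒conn : ∀ {i v} → i ∈ S → Walk i v → T (conn t n S i v)
  walk⇒conn {i} i∈S start                = iter-⊇ (length S) (_≡ᵇ i) (≡⇒≡ᵇ i i refl)
  walk⇒conn {i} i∈S (step {v = v} p u∈S v∈S e) =
    subst T (conn-closed i∈S v) (grow-along-edge (conn t n S i) u∈S v∈S (walk⇒conn i∈S p) e)

  Least : ℕ → Set
  Least r = ∀ {w} → w ∈ S → Walk r w → r ≤ w

  isRep⇒least : ∀ {r} → r ∈ S → T (isRep t n S r) → Least r
  isRep⇒least {r} r∈S rep {w} w∈S p =
    ≤ᵇ⇒≤ r w (T-implication⁻ (All.lookup (all⁺ _ S rep) w∈S) (walk⇒conn r∈S p))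

  least⇒isRep : ∀ {r} → Least r → T (isRep t n S r)
  least⇒isRep least =
    all⁻ _ (All.tabulate λ w∈S → T-implication⁺ λ c → ≤⇒≤ᵇ (least w∈S (conn⇒walk c)))

  Exit : ℕ → Set
  Exit w = ∃[ j ] j ∈ positions t × j ∉ S × T (shareRow t n w j)

  isPathComp⇒ : ∀ {r} → T (isPathComp t n S r) → ∃[ w ] w ∈ S × Walk r w × Exit w
  isPathComp⇒ path
    with w , w∈S , c∧x ← any-witness _ S path
    with c , x ← Equivalence.to T-∧ c∧x
    with j , j∈pos , j∉S∧e ← any-witness _ (positions t) x
    with j∉S , e ← Equivalence.to T-∧ j∉S∧e
    = w , w∈S , conn⇒walk c , j , j∈pos , (λ j∈S → T-not⁻ j∉S (∈⇒memb j∈S)) , e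

  isPathComp⇐ : ∀ {r w} → r ∈ S → w ∈ S → Walk r w → Exit w → T (isPathComp t n S r)
  isPathComp⇐ r∈S w∈S p (j , j∈pos , j∉S , e) = any-intro _ w∈S (Equivalence.from T-∧
    (walk⇒conn r∈S p , any-intro _ j∈pos (Equivalence.from T-∧ (T-not⁺ (j∉S ∘ memb⇒∈ S) , e))))

Adjacent : (σ τ : ℕ → ℕ) → ℕ → ℕ → Set
Adjacent σ τ v w = w ≡ v ⊎ w ≡ σ v ⊎ w ≡ τ v

module ArcCounting
  (t : ℕ) ⦃ _ : NonZero t ⦄ (n : ℕ) (S : List ℕ) (S-unique : Unique S)
  (S-indices : ∀ {i} → i ∈ S → IsIndex t i)
  (σ τ : ℕ → ℕ)
  (σ-index : ∀ {i} → IsIndex t i → IsIndex t (σ i))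
  (τσ : ∀ {i} → IsIndex t i → τ (σ i) ≡ i)
  (στ : ∀ {i} → IsIndex t i → σ (τ i) ≡ i)
  (τ-reachable : ∀ {i} → IsIndex t i → ∃[ k ] (σ ^ k) i ≡ τ i)
  (shareRow⇔ : ∀ {v w} → IsIndex t v → IsIndex t w → T (shareRow t n v w) ⇔ Adjacent σ τ v w)
  where

  open Connectivity t n S

  edge⇒adjacent : ∀ {u v} → u ∈ S → v ∈ S → T (shareRow t n u v) → Adjacent σ τ u v
  edge⇒adjacent u∈S v∈S = Equivalence.to (shareRow⇔ (S-indices u∈S) (S-indices v∈S))

  adjacent⇒edge : ∀ {u v} → IsIndex t u → IsIndex t v → Adjacent σ τ u v → T (shareRow t n u v)
  adjacent⇒edge u-idx v-idx = Equivalence.from (shareRow⇔ u-idx v-idx)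

  adjacent-sym : ∀ {v w} → IsIndex t v → Adjacent σ τ v w → Adjacent σ τ w v
  adjacent-sym v-idx (inj₁ refl)        = inj₁ refl
  adjacent-sym v-idx (inj₂ (inj₁ refl)) = inj₂ (inj₂ (sym (τσ v-idx)))
  adjacent-sym v-idx (inj₂ (inj₂ refl)) = inj₂ (inj₁ (sym (στ v-idx)))

  walk-reverse : ∀ {i v} → Walk i v → Walk v i
  walk-reverse start = start
  walk-reverse (step {u} {v} p u∈S v∈S e) = walk-++ (step start v∈S u∈S back) (walk-reverse p)
    where
    back : T (shareRow t n v u)
    back = adjacent⇒edge (S-indices v∈S) (S-indices u∈S)
             (adjacent-sym (S-indices u∈S) (edge⇒adjacent u∈S v∈S e))

  data Run (f : ℕ → ℕ) (e : ℕ) : ℕ → Set where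
    stay    : Run f e e
    advance : ∀ {v} → Run f e v → f v ∈ S → Run f e (f v)

  run-∈ : ∀ {f e v} → e ∈ S → Run f e v → v ∈ S
  run-∈ e∈S stay          = e∈S
  run-∈ e∈S (advance _ m) = m

  -- A step against the direction of a nonempty run only shortens it.
  extend : ∀ {f g e v} → (∀ {i} → IsIndex t i → f (g i) ≡ i) → e ∈ S →
    Run f e v ⊎ Run g e v → f v ∈ S → Run f e (f v) ⊎ Run g e (f v)
  extend fg e∈S (inj₁ r)                  m = inj₁ (advance r m)
  extend fg e∈S (inj₂ stay)               m = inj₁ (advance stay m)
  extend fg e∈S (inj₂ (advance r _))     m =
    inj₂ (subst (Run _ _) (sym (fg (S-indices (run-∈ e∈S r)))) r)

  walk⇒run : ∀ {e w} → e ∈ S → Walk e w → Run σ e w ⊎ Run τ e w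
  walk⇒run e∈S start = inj₁ stay
  walk⇒run e∈S (step p u∈S w∈S e) with edge⇒adjacent u∈S w∈S e
  ... | inj₁ refl        = walk⇒run e∈S p
  ... | inj₂ (inj₁ refl) = extend στ e∈S (walk⇒run e∈S p) w∈S
  ... | inj₂ (inj₂ refl) = swap (extend τσ e∈S (swap (walk⇒run e∈S p)) w∈S)

  run-from-end : ∀ {e v} → σ e ∉ S → Run σ e v → v ≡ e
  run-from-end σe∉S stay = refl
  run-from-end σe∉S (advance r m) with refl ← run-from-end σe∉S r = ⊥-elim (σe∉S m)

  backward-run-returns : ∀ {e v} → e ∈ S → Run τ e v → v ≡ e ⊎ σ v ∈ S
  backward-run-returns e∈S stay = inj₁ refl
  backward-run-returns e∈S (advance r _) =
    inj₂ (subst (_∈ S) (sym (στ (S-indices (run-∈ e∈S r)))) (run-∈ e∈S r))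

  ends-unique : ∀ {e e′} → e ∈ S → σ e ∉ S → σ e′ ∉ S → Walk e e′ → e ≡ e′
  ends-unique e∈S σe∉S σe′∉S p with walk⇒run e∈S p
  ... | inj₁ r = sym (run-from-end σe∉S r)
  ... | inj₂ r with backward-run-returns e∈S r
  ...   | inj₁ e′≡e  = sym e′≡e
  ...   | inj₂ σe′∈S = ⊥-elim (σe′∉S σe′∈S)

  End : ℕ → Set
  End r = ∃[ e ] e ∈ S × σ e ∉ S × Walk r e

  march : ∀ {r u} k → u ∈ S → Walk r u → End r ⊎ ((σ ^ k) u ∈ S × Walk r ((σ ^ k) u))
  march zero u∈S p = inj₂ (u∈S , p)
  march (suc k) u∈S p with march k u∈S p
  ... | inj₁ end = inj₁ end
  ... | inj₂ (x∈S , q) with σ _ ∈? S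
  ...   | yes σx∈S =
    inj₂ (σx∈S , step q x∈S σx∈S (adjacent⇒edge (S-indices x∈S) (S-indices σx∈S) (inj₂ (inj₁ refl))))
  ...   | no  σx∉S = inj₁ (_ , x∈S , σx∉S , q)

  -- τ w = σᵏ w, so marching forward from w leaves S before reaching τ w ∉ S.
  end-exists : ∀ {r w} → w ∈ S → Walk r w → σ w ∉ S ⊎ τ w ∉ S → End r
  end-exists w∈S p (inj₁ σw∉S) = _ , w∈S , σw∉S , p
  end-exists w∈S p (inj₂ τw∉S) with k , σᵏw≡τw ← τ-reachable (S-indices w∈S) | march k w∈S p
  ... | inj₁ end      = end
  ... | inj₂ (m , _) = ⊥-elim (τw∉S (subst (_∈ S) σᵏw≡τw m))

  exit⇒leaves : ∀ {w} → w ∈ S → Exit w → σ w ∉ S ⊎ τ w ∉ S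
  exit⇒leaves w∈S (j , j∈pos , j∉S , e)
    with Equivalence.to (shareRow⇔ (S-indices w∈S) (∈-positions⁻ {t} j∈pos)) e
  ... | inj₁ refl        = ⊥-elim (j∉S w∈S)
  ... | inj₂ (inj₁ refl) = inj₁ j∉S
  ... | inj₂ (inj₂ refl) = inj₂ j∉S

  σ-leaves⇒exit : ∀ {w} → w ∈ S → σ w ∉ S → Exit w
  σ-leaves⇒exit {w} w∈S σw∉S =
    σ w , ∈-positions⁺ {t} σw-idx , σw∉S , adjacent⇒edge (S-indices w∈S) σw-idx (inj₂ (inj₁ refl))
    where
    σw-idx : IsIndex t (σ w)
    σw-idx = σ-index (S-indices w∈S)

  least-in-component : ∀ {e} → e ∈ S → ∃[ r ] r ∈ S × Walk e r × Least r
  least-in-component {e} e∈S = r , proj₁ r∈component , proj₂ r∈component , least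
    where
    component : List ℕ
    component = filterᵇ (conn t n S e) S
    r : ℕ
    r = min e component
    r∈component : r ∈ S × Walk e r
    r∈component = argmin-all id (e∈S , start)
      (All.tabulate λ w∈ → let w∈S , c = ∈-filter⁻ (T? ∘ conn t n S e) w∈ in w∈S , conn⇒walk c)
    least : Least r
    least w∈S p = All.lookup (min≤xs e component)
      (∈-filter⁺ (T? ∘ conn t n S e) w∈S (walk⇒conn e∈S (walk-++ (proj₂ r∈component) p)))

  pathComponents≡ends : c t n S ≡ count (λ a → not (memb (σ a) S)) S
  pathComponents≡ends =
    unique-length-≡ Walk (filter⁺ (T? ∘ isPathRep) S-unique) (filter⁺ (T? ∘ isEnd) S-unique)
      rep⇒end end⇒rep reps-injective ends-injective
    where
    isPathRep isEnd : ℕ → Bool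
    isPathRep i = isRep t n S i ∧ isPathComp t n S i
    isEnd a = not (memb (σ a) S)

    rep⇒end : ∀ {r} → r ∈ filterᵇ isPathRep S → ∃[ e ] e ∈ filterᵇ isEnd S × Walk r e
    rep⇒end r∈ with r∈S , rep∧path ← ∈-filter⁻ (T? ∘ isPathRep) {xs = S} r∈
      with w , w∈S , p , exit ← isPathComp⇒ (proj₂ (Equivalence.to T-∧ rep∧path))
      with e , e∈S , σe∉S , q ← end-exists w∈S p (exit⇒leaves w∈S exit)
      = e , ∈-filter⁺ (T? ∘ isEnd) e∈S (T-not⁺ (σe∉S ∘ memb⇒∈ S)) , q

    end⇒rep : ∀ {e} → e ∈ filterᵇ isEnd S → ∃[ r ] r ∈ filterᵇ isPathRep S × Walk r e
    end⇒rep e∈ with e∈S , σe∉S ← ∈-filter⁻ (T? ∘ isEnd) {xs = S} e∈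
      with r , r∈S , p , least ← least-in-component e∈S
      = r , ∈-filter⁺ (T? ∘ isPathRep) r∈S (Equivalence.from T-∧ (least⇒isRep least ,
              isPathComp⇐ r∈S e∈S (walk-reverse p) (σ-leaves⇒exit e∈S (T-not⁻ σe∉S ∘ ∈⇒memb)))) ,
          walk-reverse p

    reps-injective : ∀ {r r′ e} → r ∈ filterᵇ isPathRep S → r′ ∈ filterᵇ isPathRep S →
      Walk r e → Walk r′ e → r ≡ r′
    reps-injective r∈ r′∈ p p′
      with r∈S  , rep∧path  ← ∈-filter⁻ (T? ∘ isPathRep) {xs = S} r∈
         | r′∈S , rep∧path′ ← ∈-filter⁻ (T? ∘ isPathRep) {xs = S} r′∈
      = ≤-antisym
          (isRep⇒least r∈S (proj₁ (Equivalence.to T-∧ rep∧path)) r′∈S (walk-++ p (walk-reverse p′)))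
          (isRep⇒least r′∈S (proj₁ (Equivalence.to T-∧ rep∧path′)) r∈S (walk-++ p′ (walk-reverse p)))

    ends-injective : ∀ {r e e′} → e ∈ filterᵇ isEnd S → e′ ∈ filterᵇ isEnd S →
      Walk r e → Walk r e′ → e ≡ e′
    ends-injective e∈ e′∈ p p′
      with e∈S , σe∉S ← ∈-filter⁻ (T? ∘ isEnd) {xs = S} e∈
         | _ , σe′∉S ← ∈-filter⁻ (T? ∘ isEnd) {xs = S} e′∈
      = ends-unique e∈S (T-not⁻ σe∉S ∘ ∈⇒memb) (T-not⁻ σe′∉S ∘ ∈⇒memb) (walk-++ (walk-reverse p) p′)

-- Row 4m+1, the row of x^m

klein-bits : ∀ q → q < 4 → q % 2 % 2 + 2 * (q / 2 % 2) ≡ q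
klein-bits 0 _ = refl
klein-bits 1 _ = refl
klein-bits 2 _ = refl
klein-bits 3 _ = refl
klein-bits (suc (suc (suc (suc _)))) (s≤s (s≤s (s≤s (s≤s ()))))

module RowGraph (t : ℕ) ⦃ _ : NonZero t ⦄ {m : ℕ} (0<m : 0 < m) (m<t : m < t) where

  row : ℕ
  row = suc (m * 4)

  σ τ : ℕ → ℕ
  σ = translate t m
  τ = translate t (t ∸ m)

  m+[t∸m]≡0 : (m + (t ∸ m)) % t ≡ 0
  m+[t∸m]≡0 = trans (cong (_% t) (m+[n∸m]≡n (<⇒≤ m<t))) (n%n≡0 t)

  [t∸m]+m≡0 : (t ∸ m + m) % t ≡ 0
  [t∸m]+m≡0 = trans (cong (_% t) (m∸n+n≡m (<⇒≤ m<t))) (n%n≡0 t)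

  τσ : ∀ {i} → IsIndex t i → τ (σ i) ≡ i
  τσ = translate-cancel t m+[t∸m]≡0

  στ : ∀ {i} → IsIndex t i → σ (τ i) ≡ i
  στ = translate-cancel t [t∸m]+m≡0

  σ-moves : ∀ {i} → IsIndex t i → σ i ≢ i
  σ-moves = translate-moves t 0<m m<t

  τ-moves : ∀ {i} → IsIndex t i → τ i ≢ i
  τ-moves i-idx τi≡i = σ-moves i-idx (trans (cong σ (sym τi≡i)) (στ i-idx))

  mul-row : ∀ j → mul t row j ≡ σ j
  mul-row j = begin
    4 * ((expX row + expX j) % t) + (expU row + q % 2) % 2 + 2 * ((expV row + q / 2) % 2) + 1
      ≡⟨ cong₂ (λ x u → 4 * ((x + expX j) % t) + (u % 2 + q % 2) % 2 + 2 * ((u / 2 + q / 2) % 2) + 1)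
               (m*n/n≡m m 4) (m*n%n≡0 m 4) ⟩
    4 * X + q % 2 % 2 + 2 * (q / 2 % 2) + 1
      ≡⟨ cong (_+ 1) (trans (+-assoc (4 * X) _ _) (cong (4 * X +_) (klein-bits q (klein<4 j)))) ⟩
    4 * X + q + 1
      ≡⟨ trans (+-comm (4 * X + q) 1) (cong suc (trans (+-comm (4 * X) q) (cong (q +_) (*-comm 4 X)))) ⟩
    suc (q + X * 4) ∎
    where
    open ≡-Reasoning
    q X : ℕ
    q = klein j
    X = (m + expX j) % t

  negEntry⇒ : ∀ {i j} → IsIndex t j → T (negEntry t i row j) → j ≡ i ⊎ j ≡ τ i
  negEntry⇒ {i} {j} j-idx neg with T-xor⁻ neg
  ... | inj₁ j≡i  = inj₁ (≡ᵇ⇒≡ j i j≡i)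
  ... | inj₂ σj≡i = inj₂ (trans (sym (τσ j-idx)) (cong τ (trans (sym (mul-row j)) (≡ᵇ⇒≡ _ i σj≡i))))

  negEntry⇐ : ∀ {i j} → IsIndex t i → j ≡ i ⊎ j ≡ τ i → T (negEntry t i row j)
  negEntry⇐ {i} i-idx (inj₁ refl) =
    T-xor⁺ˡ (≡⇒≡ᵇ i i refl) λ σi≡i → σ-moves i-idx (trans (sym (mul-row i)) (≡ᵇ⇒≡ _ i σi≡i))
  negEntry⇐ {i} i-idx (inj₂ refl) =
    T-xor⁺ʳ (τ-moves i-idx ∘ ≡ᵇ⇒≡ _ i) (≡⇒≡ᵇ _ i (trans (mul-row (τ i)) (στ i-idx)))

  shareRow⇔ : ∀ {v w} → IsIndex t v → IsIndex t w → T (shareRow t row v w) ⇔ Adjacent σ τ v w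
  shareRow⇔ {v} {w} v-idx w-idx = mk⇔ to from
    where
    to : T (shareRow t row v w) → Adjacent σ τ v w
    to share with j , j∈pos , both ← any-witness _ (positions t) share
      with v-neg , w-neg ← Equivalence.to T-∧ both
      with negEntry⇒ (∈-positions⁻ {t} j∈pos) v-neg | negEntry⇒ (∈-positions⁻ {t} j∈pos) w-neg
    ... | inj₁ refl | inj₁ refl = inj₁ refl
    ... | inj₁ refl | inj₂ v≡τw = inj₂ (inj₁ (trans (sym (στ w-idx)) (cong σ (sym v≡τw))))
    ... | inj₂ refl | inj₁ refl = inj₂ (inj₂ refl)
    ... | inj₂ j≡τv | inj₂ j≡τw =
      inj₁ (trans (sym (στ w-idx)) (trans (cong σ (trans (sym j≡τw) j≡τv)) (στ v-idx)))
    from : Adjacent σ τ v w → T (shareRow t row v w)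
    from (inj₁ refl) = any-intro _ (∈-positions⁺ {t} v-idx)
      (Equivalence.from T-∧ (negEntry⇐ v-idx (inj₁ refl) , negEntry⇐ v-idx (inj₁ refl)))
    from (inj₂ (inj₁ refl)) = any-intro _ (∈-positions⁺ {t} v-idx)
      (Equivalence.from T-∧ (negEntry⇐ v-idx (inj₁ refl) , negEntry⇐ w-idx (inj₂ (sym (τσ v-idx)))))
    from (inj₂ (inj₂ refl)) = any-intro _ (∈-positions⁺ {t} w-idx)
      (Equivalence.from T-∧ (negEntry⇐ v-idx (inj₂ refl) , negEntry⇐ w-idx (inj₁ refl)))

  module _ (S : List ℕ) (S-unique : Unique S) (S-indices : ∀ {i} → i ∈ S → IsIndex t i) where

    pathComponents≡σ-ends : c t row S ≡ count (λ a → not (memb (σ a) S)) S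
    pathComponents≡σ-ends = ArcCounting.pathComponents≡ends t row S S-unique S-indices σ τ
      (λ {i} _ → translate-isIndex t m i) τσ στ
      (λ i-idx → pred t , translate-inverse-reachable t m+[t∸m]≡0 i-idx)
      shareRow⇔

    pathComponents≡τ-ends : c t row S ≡ count (λ a → not (memb (τ a) S)) S
    pathComponents≡τ-ends = ArcCounting.pathComponents≡ends t row S S-unique S-indices τ σ
      (λ {i} _ → translate-isIndex t (t ∸ m) i) στ τσ
      (λ i-idx → pred t , translate-inverse-reachable t [t∸m]+m≡0 i-idx)
      (λ v-idx w-idx → let r = shareRow⇔ v-idx w-idx in
        mk⇔ (map₂ swap ∘ Equivalence.to r) (Equivalence.from r ∘ map₂ swap))

≡1-mod-4 : ℕ → Bool
≡1-mod-4 n = n % 4 ≡ᵇ 1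

private
  residue : ∀ q i → suc (q * 4 + i) % 4 ≡ suc i % 4
  residue q i = trans (cong (λ z → suc z % 4) (+-comm (q * 4) i)) ([m+kn]%n≡m%n (suc i) q 4)

  kept : ∀ q → T (≡1-mod-4 (suc (q * 4 + 0)))
  kept q = subst (λ z → T (z ≡ᵇ 1)) (sym (residue q 0)) _

  dropped : ∀ q i → ¬ T (suc i % 4 ≡ᵇ 1) → ¬ T (≡1-mod-4 (suc (q * 4 + i)))
  dropped q i ¬1 = ¬1 ∘ subst (λ z → T (z ≡ᵇ 1)) (residue q i)

filter-≡1-mod-4 : ∀ q h →
  filterᵇ ≡1-mod-4 (applyUpTo (λ i → suc (q * 4 + i)) (h * 4)) ≡ applyUpTo (λ x → suc ((q + x) * 4)) h
filter-≡1-mod-4 q zero    = refl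
filter-≡1-mod-4 q (suc h) = begin
  filterᵇ ≡1-mod-4 (f 0 ∷ f 1 ∷ f 2 ∷ f 3 ∷ applyUpTo (λ i → f (4 + i)) (h * 4))
    ≡⟨ filter-accept (T? ∘ ≡1-mod-4) (kept q) ⟩
  f 0 ∷ filterᵇ ≡1-mod-4 (f 1 ∷ f 2 ∷ f 3 ∷ applyUpTo (λ i → f (4 + i)) (h * 4))
    ≡⟨ cong (f 0 ∷_) (trans (filter-reject (T? ∘ ≡1-mod-4) {f 1} {f 2 ∷ f 3 ∷ rest} (dropped q 1 id))
                     (trans (filter-reject (T? ∘ ≡1-mod-4) {f 2} {f 3 ∷ rest} (dropped q 2 id))
                            (filter-reject (T? ∘ ≡1-mod-4) {f 3} {rest} (dropped q 3 id)))) ⟩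
  f 0 ∷ filterᵇ ≡1-mod-4 (applyUpTo (λ i → f (4 + i)) (h * 4))
    ≡⟨ cong₂ _∷_ (cong suc (trans (+-identityʳ (q * 4)) (cong (_* 4) (sym (+-identityʳ q)))))
                 (cong (filterᵇ ≡1-mod-4) (applyUpTo-cong (h * 4) λ {i} _ → cong suc (regroup i))) ⟩
  suc ((q + 0) * 4) ∷ filterᵇ ≡1-mod-4 (applyUpTo (λ i → suc (suc q * 4 + i)) (h * 4))
    ≡⟨ cong (_ ∷_) (trans (filter-≡1-mod-4 (suc q) h)
                          (applyUpTo-cong h λ {x} _ → cong (λ z → suc (z * 4)) (sym (+-suc q x)))) ⟩
  applyUpTo (λ x → suc ((q + x) * 4)) (suc h) ∎
  where
  open ≡-Reasoning
  f : ℕ → ℕ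
  f i = suc (q * 4 + i)
  rest : List ℕ
  rest = applyUpTo (λ i → f (4 + i)) (h * 4)
  regroup : ∀ i → q * 4 + (4 + i) ≡ suc q * 4 + i
  regroup i = trans (sym (+-assoc (q * 4) 4 i)) (cong (_+ i) (+-comm (q * 4) 4))

rows-odd : ∀ {t} h → t ≡ suc (h + h) → rows t ≡ applyUpTo (λ x → suc (suc x * 4)) h
rows-odd h refl = begin
  filterᵇ ≡1-mod-4 (map (5 +_) (upTo (2 * suc (h + h) ∸ 2)))
    ≡⟨ cong (filterᵇ ≡1-mod-4) (map-upTo (5 +_) (2 * suc (h + h) ∸ 2)) ⟩
  filterᵇ ≡1-mod-4 (applyUpTo (5 +_) (2 * suc (h + h) ∸ 2))
    ≡⟨ cong (λ k → filterᵇ ≡1-mod-4 (applyUpTo (5 +_) k)) length≡ ⟩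
  filterᵇ ≡1-mod-4 (applyUpTo (5 +_) (h * 4))
    ≡⟨ filter-≡1-mod-4 1 h ⟩
  applyUpTo (λ x → suc (suc x * 4)) h ∎
  where
  open ≡-Reasoning
  2[h+h]≡h*4 : ∀ h → 2 * (h + h) ≡ h * 4
  2[h+h]≡h*4 = solve-∀
  length≡ : 2 * suc (h + h) ∸ 2 ≡ h * 4
  length≡ = trans (cong (_∸ 2) (*-suc 2 (h + h))) (2[h+h]≡h*4 h)

module _ (t : ℕ) ⦃ _ : NonZero t ⦄ {h : ℕ} (t≡2h+1 : t ≡ suc (h + h))
  {S : List ℕ} (S-unique : Unique S) {q : ℕ} (S-coset : ∀ {i} → i ∈ S → IsIndex t i × klein i ≡ q) where

  private
    outside : ℕ → ℕ → Bool
    outside d a = not (memb (translate t d a) S)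

    E : ℕ → ℕ
    E d = count (outside d) S

    C : ℕ → ℕ
    C x = c t (suc (suc x * 4)) S

    S-indices : ∀ {i} → i ∈ S → IsIndex t i
    S-indices = proj₁ ∘ S-coset

    row<t : ∀ {x} → x < h → suc x < t
    row<t x<h = subst (_ <_) (sym t≡2h+1) (s≤s (≤-trans x<h (m≤m+n h h)))

    C≡E : ∀ {x} → x < h → C x ≡ E (suc x)
    C≡E x<h = RowGraph.pathComponents≡σ-ends t z<s (row<t x<h) S S-unique S-indices

    C≡E-opposite : ∀ {x} → x < h → C x ≡ E (suc (h + (h ∸ suc x)))
    C≡E-opposite {x} x<h =
      trans (RowGraph.pathComponents≡τ-ends t z<s (row<t x<h) S S-unique S-indices)
            (cong E (trans (cong (_∸ suc x) t≡2h+1) mirror))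
      where
      mirror : h + h ∸ x ≡ suc (h + (h ∸ suc x))
      mirror = trans (+-∸-assoc h (<⇒≤ x<h)) (trans (cong (h +_) (+-∸-assoc 1 x<h)) (+-suc h _))

    outside-count : ∀ {a} → a ∈ S → count (λ d → outside d a) (applyUpTo suc (h + h)) ≡ t ∸ length S
    outside-count {a} a∈S = begin
      count (λ d → outside d a) (applyUpTo suc (h + h))
        ≡⟨ cong (_+ count (λ d → outside d a) (applyUpTo suc (h + h))) a-inside ⟨
      indicator (outside 0 a) + count (λ d → outside d a) (applyUpTo suc (h + h))
        ≡⟨ count-∷ (λ d → outside d a) 0 _ ⟨
      count (λ d → outside d a) (upTo (suc (h + h)))
        ≡⟨ cong (count (λ d → outside d a) ∘ upTo) t≡2h+1 ⟨
      count (λ d → outside d a) (upTo t)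
        ≡⟨ count-translates-∉ t (S-indices a∈S) S-unique same-coset ⟩
      t ∸ length S ∎
      where
      open ≡-Reasoning
      a-inside : indicator (outside 0 a) ≡ 0
      a-inside = cong (indicator ∘ not) (Equivalence.to T-≡
        (∈⇒memb (subst (_∈ S) (sym (translate-zero t (S-indices a∈S))) a∈S)))
      same-coset : ∀ {b} → b ∈ S → IsIndex t b × klein b ≡ klein a
      same-coset b∈S = S-indices b∈S , trans (proj₂ (S-coset b∈S)) (sym (proj₂ (S-coset a∈S)))

    ΣC≡lower : sum (applyUpTo C h) ≡ sum (applyUpTo (E ∘ suc) h)
    ΣC≡lower = cong sum (applyUpTo-cong h C≡E)

    ΣC≡upper : sum (applyUpTo C h) ≡ sum (applyUpTo (λ y → E (suc (h + y))) h)
    ΣC≡upper = trans (cong sum (applyUpTo-cong h C≡E-opposite))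
                     (sum-applyUpTo-reverse (λ y → E (suc (h + y))) h)

    sumC≡ΣC : sumC t S ≡ sum (applyUpTo C h)
    sumC≡ΣC = trans (cong (λ rs → sum (map (λ n → c t n S) rs)) (rows-odd h t≡2h+1))
                    (cong sum (map-applyUpTo (λ x → suc (suc x * 4)) (λ n → c t n S) h))

  double-sumC : 2 * sumC t S ≡ length S * (t ∸ length S)
  double-sumC = begin
    2 * sumC t S
      ≡⟨ cong (2 *_) sumC≡ΣC ⟩
    2 * sum (applyUpTo C h)
      ≡⟨ cong (sum (applyUpTo C h) +_) (+-identityʳ _) ⟩
    sum (applyUpTo C h) + sum (applyUpTo C h)
      ≡⟨ cong₂ _+_ ΣC≡lower ΣC≡upper ⟩
    sum (applyUpTo (E ∘ suc) h) + sum (applyUpTo (λ y → E (suc (h + y))) h)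
      ≡⟨ sum-++ (applyUpTo (E ∘ suc) h) _ ⟨
    sum (applyUpTo (E ∘ suc) h ++ applyUpTo (λ y → E (suc (h + y))) h)
      ≡⟨ cong sum (applyUpTo-+ (E ∘ suc) h h) ⟨
    sum (applyUpTo (E ∘ suc) (h + h))
      ≡⟨ cong sum (map-applyUpTo suc E (h + h)) ⟨
    sum (map E (applyUpTo suc (h + h)))
      ≡⟨ sum-count-swap outside (applyUpTo suc (h + h)) S ⟩
    sum (map (λ a → count (λ d → outside d a) (applyUpTo suc (h + h))) S)
      ≡⟨ cong sum (map-cong-local (All.tabulate outside-count)) ⟩
    sum (map (λ _ → t ∸ length S) S)
      ≡⟨ sum-map-const (t ∸ length S) S ⟩
    length S * (t ∸ length S) ∎
    where open ≡-Reasoning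

corollary3 : (t : ℕ) ⦃ _ : NonZero t ⦄ → 1 < t → t % 2 ≡ 1 →
    (r : ℕ) → 1 ≤ r → r ≤ 4 →
    (S : List ℕ) → Unique S →
    All (λ i → 1 ≤ i × i ≤ 4 * t × i % 4 ≡ r % 4) S →
    (k : ℕ) → length S ≡ k →
    2 * sumC t S ≡ k * (t ∸ k)
corollary3 t _ t-odd r _ _ S S-unique S-class _ refl = double-sumC t {h} t≡2h+1 S-unique coset
  where
  h : ℕ
  h = t / 2
  t≡2h+1 : t ≡ suc (h + h)
  t≡2h+1 = trans (m≡m%n+[m/n]*n t 2)
                  (cong₂ _+_ t-odd (trans (*-comm h 2) (cong (h +_) (+-identityʳ h))))
  coset : ∀ {i} → i ∈ S → IsIndex t i × klein i ≡ (r % 4 + 3) % 4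
  coset i∈S with 1≤i , i≤4t , i≡r ← All.lookup S-class i∈S =
    (1≤i , i≤4t) , trans (klein-from-mod-4 1≤i) (cong (λ z → (z + 3) % 4) i≡r)
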